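{- Let $\mathfrak{Ba}$ be the countable atomless Boolean algebra with universe $B$, regarded as a Boolean ring, and let $M(x,y,z)=xy+yz+zx$ be the median (equal to $(x\vee y)\wedge(y\vee z)\wedge(z\vee x)$). Let $\mathrm{Aut}(M)$ be the group of all permutations of $B$ preserving $M$, and let $T=\{t_c : c\in B\}$ where $t_c(a)=a+c$. Then $\mathrm{Aut}(M)=T\rtimes\mathrm{Aut}(\mathfrak{Ba})$.
   Context: $\mathfrak{Ba}$ is viewed as a Boolean ring $(B,+,\cdot,0,1)$ with $+$ symmetric difference and $\cdot$ meet. A permutation $\varphi$ preserves $M$ if $\varphi(M(a,b,c))=M(\varphi(a),\varphi(b),\varphi(c))$ for all $a,b,c$. The semidirect product notation means $T$ is a normal subgroup of $\mathrm{Aut}(M)$, $T\cap\mathrm{Aut}(\mathfrak{Ba})$ is trivial, and $\mathrm{Aut}(M)$ is generated by $T$ and $\mathrm{Aut}(\mathfrak{Ba})$. -}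

module Defs where

open import Level using (0ℓ)
open import Data.Nat using (ℕ)
open import Data.Product using (Σ; ∃; _×_; _,_)
open import Relation.Nullary using (¬_)
open import Relation.Binary.PropositionalEquality using (_≡_)
open import Algebra.Structures using (IsCommutativeRing)
open import Function.Bundles using (_↔_; _↠_; Inverse)

record BooleanRing : Set₁ where
  infixl 6 _+_
  infixl 7 _·_
  field
    Carrier      : Set
    _+_ _·_      : Carrier → Carrier → Carrier
    -_           : Carrier → Carrier
    0# 1#        : Carrier
    isCommRing   : IsCommutativeRing _≡_ _+_ _·_ -_ 0# 1#
    idempotent   : ∀ x → x · x ≡ x

module _ (R : BooleanRing) where
  open BooleanRing R

  _≤B_ : Carrier → Carrier → Set
  b ≤B a = b · a ≡ b

  Nontrivial : Set
  Nontrivial = ¬ (0# ≡ 1#)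

  Atomless : Set
  Atomless = ∀ a → ¬ (a ≡ 0#) → ∃ λ b → ¬ (b ≡ 0#) × ¬ (b ≡ a) × b ≤B a

  Countable : Set
  Countable = ℕ ↠ Carrier

  median : Carrier → Carrier → Carrier → Carrier
  median x y z = x · y + y · z + z · x

  Perm : Set
  Perm = Carrier ↔ Carrier

  PreservesM : Perm → Set
  PreservesM φ = ∀ a b c →
    Inverse.to φ (median a b c) ≡ median (Inverse.to φ a) (Inverse.to φ b) (Inverse.to φ c)

  IsBAAut : Perm → Set
  IsBAAut φ = (∀ a b → Inverse.to φ (a + b) ≡ Inverse.to φ a + Inverse.to φ b)
            × (∀ a b → Inverse.to φ (a · b) ≡ Inverse.to φ a · Inverse.to φ b)
            × (Inverse.to φ 0# ≡ 0#)
            × (Inverse.to φ 1# ≡ 1#)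

  translate : Carrier → Carrier → Carrier
  translate c a = a + c

  InT : Perm → Set
  InT φ = ∃ λ c → ∀ a → Inverse.to φ a ≡ translate c a

  conj : Perm → Perm → (Carrier → Carrier)
  conj ψ φ a = Inverse.to ψ (Inverse.to φ (Inverse.from ψ a))

  -- The subgroup of Sym(B) generated by T ∪ Aut(𝔅𝔞): all finite words
  -- g₁ ∘ ... ∘ gₙ where each gᵢ is an element of T ∪ Aut(𝔅𝔞) or the
  -- inverse of one.
  data Generated : (Carrier → Carrier) → Set where
    gen-id    : Generated (λ a → a)
    gen-T     : ∀ {f} (φ : Perm) → InT φ → Generated f
              → Generated (λ a → Inverse.to φ (f a))
    gen-T⁻¹   : ∀ {f} (φ : Perm) → InT φ → Generated f
              → Generated (λ a → Inverse.from φ (f a))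
    gen-Aut   : ∀ {f} (φ : Perm) → IsBAAut φ → Generated f
              → Generated (λ a → Inverse.to φ (f a))
    gen-Aut⁻¹ : ∀ {f} (φ : Perm) → IsBAAut φ → Generated f
              → Generated (λ a → Inverse.from φ (f a))

  SemidirectDecomposition : Set
  SemidirectDecomposition =
      (∀ φ → InT φ → PreservesM φ)
    × (∀ φ → IsBAAut φ → PreservesM φ)
    × (∀ ψ φ → PreservesM ψ → InT φ → ∃ λ c → ∀ a → conj ψ φ a ≡ translate c a)
    × (∀ φ → InT φ → IsBAAut φ → ∀ a → Inverse.to φ a ≡ a)
    × (∀ φ → PreservesM φ → ∃ λ g → Generated g × (∀ a → Inverse.to φ a ≡ g a))

-- The decomposition holds in every Boolean ring.  The argument:
--   * Boolean rings have characteristic 2, so translations t_c are involutions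
--     and M(a+c, b+c, d+c) = M(a,b,d) + c; hence T ⊆ Aut(M).  Ring
--     automorphisms preserve the polynomial M, so Aut(𝔅𝔞) ⊆ Aut(M).
--   * The median recovers the lattice operations: M(x,0,y) = x ∧ y and
--     M(x,y,1) = x ∨ y.  Hence a surjective median-preserving map fixing 0
--     preserves ∧, then 1, ∨, complements (by uniqueness of complements) and
--     finally + since x + y = (x ∨ y) ∧ ¬(x ∧ y): it is a ring endomorphism.
--   * For ψ ∈ Aut(M) the normalised map f(a) = ψ(a) + ψ(0) is such a map, so
--     ψ = t_{ψ(0)} ∘ f with f ∈ Aut(𝔅𝔞) (generation), ψ t_c ψ⁻¹ = t_{f(c)}
--     (normality), and a translation fixing 0 is the identity (trivial
--     intersection).
module Submission where

open import Defs
open import Data.Product using (∃; _×_; _,_)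
open import Function.Bundles using (Inverse; mk↔ₛ′)
open import Relation.Binary.PropositionalEquality
open import Algebra.Bundles using (CommutativeRing)

module BooleanRingTheory (R : BooleanRing) where
  open BooleanRing R
  open ≡-Reasoning

  commutativeRing : CommutativeRing _ _
  commutativeRing = record { isCommutativeRing = isCommRing }

  open CommutativeRing commutativeRing using (+-identityˡ; +-identityʳ; -‿inverseʳ; +-assoc; +-comm)
  open import Algebra.Solver.Ring.NaturalCoefficients.Default
    (CommutativeRing.commutativeSemiring commutativeRing)

  _∨_ : Carrier → Carrier → Carrier
  x ∨ y = (x + y) + x · y

  ∁ : Carrier → Carrier
  ∁ x = 1# + x

  -- Characteristic 2: from x + x = (x + x)² = 4x one gets x + x = 0.
  char-two : ∀ x → x + x ≡ 0#
  char-two x = begin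
      x + x                                  ≡⟨ sym (+-identityʳ (x + x)) ⟩
      (x + x) + 0#                           ≡⟨ cong ((x + x) +_) (sym (-‿inverseʳ (x + x))) ⟩
      (x + x) + ((x + x) + - (x + x))        ≡⟨ sym (+-assoc (x + x) (x + x) (- (x + x))) ⟩
      ((x + x) + (x + x)) + - (x + x)        ≡⟨ cong (_+ - (x + x)) (sym double-is-quadruple) ⟩
      (x + x) + - (x + x)                    ≡⟨ -‿inverseʳ (x + x) ⟩
      0#                                     ∎
    where
    double-is-quadruple : x + x ≡ (x + x) + (x + x)
    double-is-quadruple = begin
        x + x                                ≡⟨ sym (idempotent (x + x)) ⟩
        (x + x) · (x + x)                    ≡⟨ solve 1 (λ u → (u :+ u) :* (u :+ u)
                                                  := (u :* u :+ u :* u) :+ (u :* u :+ u :* u)) refl x ⟩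
        (x · x + x · x) + (x · x + x · x)    ≡⟨ cong (λ p → (p + p) + (p + p)) (idempotent x) ⟩
        (x + x) + (x + x)                    ∎

  +-cancel : ∀ u v → (u + v) + v ≡ u
  +-cancel u v = begin
      (u + v) + v   ≡⟨ +-assoc u v v ⟩
      u + (v + v)   ≡⟨ cong (u +_) (char-two v) ⟩
      u + 0#        ≡⟨ +-identityʳ u ⟩
      u             ∎

  median-translate : ∀ a b d c → median R (a + c) (b + c) (d + c) ≡ median R a b d + c
  median-translate a b d c = begin
      median R (a + c) (b + c) (d + c)
    ≡⟨ solve 4 (λ a b d c → ((a :+ c) :* (b :+ c) :+ (b :+ c) :* (d :+ c)) :+ (d :+ c) :* (a :+ c)
                 := ((a :* b :+ b :* d) :+ d :* a) :+ ((c :+ c) :* ((a :+ b) :+ d) :+ ((c :* c :+ c :* c) :+ c :* c)))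
               refl a b d c ⟩
      m + ((c + c) · s + ((c · c + c · c) + c · c))
    ≡⟨ cong₂ (λ p q → m + (p · s + ((q + q) + q))) (char-two c) (idempotent c) ⟩
      m + (0# · s + ((c + c) + c))
    ≡⟨ cong (λ p → m + (0# · s + (p + c))) (char-two c) ⟩
      m + (0# · s + (0# + c))
    ≡⟨ solve 3 (λ m s c → m :+ (con 0 :* s :+ (con 0 :+ c)) := m :+ c) refl m s c ⟩
      m + c
    ∎
    where
    m = median R a b d
    s = (a + b) + d

  median-meet : ∀ x y → median R x 0# y ≡ x · y
  median-meet = solve 2 (λ x y → (x :* con 0 :+ con 0 :* y) :+ y :* x := x :* y) refl

  median-join : ∀ x y → median R x y 1# ≡ x ∨ y
  median-join = solve 2 (λ x y → (x :* y :+ y :* con 1) :+ con 1 :* x := (x :+ y) :+ x :* y) refl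

  ∧-complement : ∀ x → x · ∁ x ≡ 0#
  ∧-complement x = begin
      x · (1# + x)   ≡⟨ solve 1 (λ x → x :* (con 1 :+ x) := x :+ x :* x) refl x ⟩
      x + x · x      ≡⟨ cong (x +_) (idempotent x) ⟩
      x + x          ≡⟨ char-two x ⟩
      0#             ∎

  ∨-complement : ∀ x → x ∨ ∁ x ≡ 1#
  ∨-complement x = begin
      (x + (1# + x)) + x · (1# + x)   ≡⟨ cong ((x + (1# + x)) +_) (∧-complement x) ⟩
      (x + (1# + x)) + 0#             ≡⟨ solve 1 (λ x → (x :+ (con 1 :+ x)) :+ con 0 := con 1 :+ (x :+ x)) refl x ⟩
      1# + (x + x)                    ≡⟨ cong (1# +_) (char-two x) ⟩
      1# + 0#                         ≡⟨ +-identityʳ 1# ⟩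
      1#                              ∎

  complement-unique : ∀ u v → u · v ≡ 0# → u ∨ v ≡ 1# → v ≡ ∁ u
  complement-unique u v disjoint covering = begin
      v                        ≡⟨ sym (+-cancel v u) ⟩
      (v + u) + u              ≡⟨ cong (_+ u) (solve 2 (λ u v → v :+ u := (u :+ v) :+ con 0) refl u v) ⟩
      ((u + v) + 0#) + u       ≡⟨ cong (λ w → ((u + v) + w) + u) (sym disjoint) ⟩
      (u ∨ v) + u              ≡⟨ cong (_+ u) covering ⟩
      1# + u                   ∎

  +-via-lattice : ∀ x y → (x ∨ y) · ∁ (x · y) ≡ x + y
  +-via-lattice x y = begin
      ((x + y) + x · y) · (1# + x · y)
    ≡⟨ solve 2 (λ x y → ((x :+ y) :+ x :* y) :* (con 1 :+ x :* y)
            := (x :+ y) :+ ((x :* y :+ (x :* x) :* y) :+ (x :* (y :* y) :+ (x :* x) :* (y :* y)))) refl x y ⟩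
      (x + y) + ((x · y + (x · x) · y) + (x · (y · y) + (x · x) · (y · y)))
    ≡⟨ cong₂ (λ p q → (x + y) + ((x · y + p · y) + (x · q + p · q))) (idempotent x) (idempotent y) ⟩
      (x + y) + ((x · y + x · y) + (x · y + x · y))
    ≡⟨ cong (λ p → (x + y) + (p + p)) (char-two (x · y)) ⟩
      (x + y) + (0# + 0#)
    ≡⟨ cong ((x + y) +_) (+-identityˡ 0#) ⟩
      (x + y) + 0#
    ≡⟨ +-identityʳ (x + y) ⟩
      x + y
    ∎

  module MedianMapFixingZero
    (f g : Carrier → Carrier) (section : ∀ y → f (g y) ≡ y)
    (preserves-median : ∀ a b c → f (median R a b c) ≡ median R (f a) (f b) (f c))
    (fixes-0 : f 0# ≡ 0#) where

    preserves-· : ∀ x y → f (x · y) ≡ f x · f y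
    preserves-· x y = begin
        f (x · y)                     ≡⟨ cong f (sym (median-meet x y)) ⟩
        f (median R x 0# y)           ≡⟨ preserves-median x 0# y ⟩
        median R (f x) (f 0#) (f y)   ≡⟨ cong (λ z → median R (f x) z (f y)) fixes-0 ⟩
        median R (f x) 0# (f y)       ≡⟨ median-meet (f x) (f y) ⟩
        f x · f y                     ∎

    -- f 1 is a unit for the image of f, which is everything.
    preserves-1 : f 1# ≡ 1#
    preserves-1 = begin
        f 1#               ≡⟨ solve 1 (λ z → z := con 1 :* z) refl (f 1#) ⟩
        1# · f 1#          ≡⟨ cong (_· f 1#) (sym (section 1#)) ⟩
        f (g 1#) · f 1#    ≡⟨ sym (preserves-· (g 1#) 1#) ⟩
        f (g 1# · 1#)      ≡⟨ cong f (solve 1 (λ z → z :* con 1 := z) refl (g 1#)) ⟩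
        f (g 1#)           ≡⟨ section 1# ⟩
        1#                 ∎

    preserves-∨ : ∀ x y → f (x ∨ y) ≡ f x ∨ f y
    preserves-∨ x y = begin
        f (x ∨ y)                     ≡⟨ cong f (sym (median-join x y)) ⟩
        f (median R x y 1#)           ≡⟨ preserves-median x y 1# ⟩
        median R (f x) (f y) (f 1#)   ≡⟨ cong (median R (f x) (f y)) preserves-1 ⟩
        median R (f x) (f y) 1#       ≡⟨ median-join (f x) (f y) ⟩
        f x ∨ f y                     ∎

    preserves-∁ : ∀ x → f (∁ x) ≡ ∁ (f x)
    preserves-∁ x = complement-unique (f x) (f (∁ x)) disjoint covering
      where
      disjoint : f x · f (∁ x) ≡ 0#
      disjoint = trans (sym (preserves-· x (∁ x))) (trans (cong f (∧-complement x)) fixes-0)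
      covering : f x ∨ f (∁ x) ≡ 1#
      covering = trans (sym (preserves-∨ x (∁ x))) (trans (cong f (∨-complement x)) preserves-1)

    preserves-+ : ∀ x y → f (x + y) ≡ f x + f y
    preserves-+ x y = begin
        f (x + y)                          ≡⟨ cong f (sym (+-via-lattice x y)) ⟩
        f ((x ∨ y) · ∁ (x · y))            ≡⟨ preserves-· (x ∨ y) (∁ (x · y)) ⟩
        f (x ∨ y) · f (∁ (x · y))          ≡⟨ cong₂ _·_ (preserves-∨ x y)
                                                (trans (preserves-∁ (x · y)) (cong ∁ (preserves-· x y))) ⟩
        (f x ∨ f y) · ∁ (f x · f y)        ≡⟨ +-via-lattice (f x) (f y) ⟩
        f x + f y                          ∎

  translation : Carrier → Perm R
  translation c = mk↔ₛ′ (translate R c) (translate R c) (λ y → +-cancel y c) (λ y → +-cancel y c)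

  module Normalised (ψ : Perm R) (ψ-median : PreservesM R ψ) where
    open Inverse ψ using (strictlyInverseˡ; strictlyInverseʳ) renaming (to to ψ→; from to ψ←)

    offset : Carrier
    offset = ψ→ 0#

    f g : Carrier → Carrier
    f a = ψ→ a + offset
    g a = ψ← (a + offset)

    section : ∀ y → f (g y) ≡ y
    section y = trans (cong (_+ offset) (strictlyInverseˡ (y + offset))) (+-cancel y offset)

    retraction : ∀ y → g (f y) ≡ y
    retraction y = trans (cong ψ← (+-cancel (ψ→ y) offset)) (strictlyInverseʳ y)

    f-median : ∀ a b c → f (median R a b c) ≡ median R (f a) (f b) (f c)
    f-median a b c = trans (cong (_+ offset) (ψ-median a b c))
                           (sym (median-translate (ψ→ a) (ψ→ b) (ψ→ c) offset))

    open MedianMapFixingZero f g section f-median (char-two offset) public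

    decompose : ∀ a → ψ→ a ≡ f a + offset
    decompose a = sym (+-cancel (ψ→ a) offset)

    automorphism : Perm R
    automorphism = mk↔ₛ′ f g section retraction

    automorphism-isBAAut : IsBAAut R automorphism
    automorphism-isBAAut = preserves-+ , preserves-· , char-two offset , preserves-1

  T⊆Aut[M] : ∀ φ → InT R φ → PreservesM R φ
  T⊆Aut[M] φ (c , φ≗t) a b d = begin
      φ→ (median R a b d)                 ≡⟨ φ≗t (median R a b d) ⟩
      median R a b d + c                  ≡⟨ sym (median-translate a b d c) ⟩
      median R (a + c) (b + c) (d + c)    ≡⟨ sym (cong₂ (λ p q → median R p q (d + c)) (φ≗t a) (φ≗t b)) ⟩
      median R (φ→ a) (φ→ b) (d + c)      ≡⟨ sym (cong (median R (φ→ a) (φ→ b)) (φ≗t d)) ⟩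
      median R (φ→ a) (φ→ b) (φ→ d)       ∎
    where open Inverse φ renaming (to to φ→)

  Aut[Ba]⊆Aut[M] : ∀ φ → IsBAAut R φ → PreservesM R φ
  Aut[Ba]⊆Aut[M] φ (φ-+ , φ-· , _ , _) a b d = begin
      φ→ ((a · b + b · d) + d · a)            ≡⟨ φ-+ (a · b + b · d) (d · a) ⟩
      φ→ (a · b + b · d) + φ→ (d · a)         ≡⟨ cong₂ _+_ (φ-+ (a · b) (b · d)) (φ-· d a) ⟩
      (φ→ (a · b) + φ→ (b · d)) + φ→ d · φ→ a ≡⟨ cong₂ (λ p q → (p + q) + φ→ d · φ→ a) (φ-· a b) (φ-· b d) ⟩
      median R (φ→ a) (φ→ b) (φ→ d)           ∎
    where open Inverse φ renaming (to to φ→)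

  T-normal : ∀ ψ φ → PreservesM R ψ → InT R φ → ∃ λ c → ∀ a → conj R ψ φ a ≡ translate R c a
  T-normal ψ φ ψ-median (c , φ≗t) = f c , λ a → begin
      ψ→ (φ→ (ψ← a))                        ≡⟨ cong ψ→ (φ≗t (ψ← a)) ⟩
      ψ→ (ψ← a + c)                         ≡⟨ decompose (ψ← a + c) ⟩
      f (ψ← a + c) + offset                 ≡⟨ cong (_+ offset) (preserves-+ (ψ← a) c) ⟩
      ((ψ→ (ψ← a) + offset) + f c) + offset ≡⟨ cong (_+ offset) (+-assoc (ψ→ (ψ← a)) offset (f c)) ⟩
      (ψ→ (ψ← a) + (offset + f c)) + offset ≡⟨ cong (λ z → (ψ→ (ψ← a) + z) + offset) (+-comm offset (f c)) ⟩
      (ψ→ (ψ← a) + (f c + offset)) + offset ≡⟨ cong (_+ offset) (sym (+-assoc (ψ→ (ψ← a)) (f c) offset)) ⟩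
      ((ψ→ (ψ← a) + f c) + offset) + offset ≡⟨ +-cancel (ψ→ (ψ← a) + f c) offset ⟩
      ψ→ (ψ← a) + f c                       ≡⟨ cong (_+ f c) (Inverse.strictlyInverseˡ ψ a) ⟩
      a + f c                               ∎
    where
    open Normalised ψ ψ-median
    open Inverse ψ renaming (to to ψ→; from to ψ←)
    open Inverse φ renaming (to to φ→)

  -- A translation that is a ring automorphism fixes 0, hence translates by 0.
  T∩Aut[Ba]-trivial : ∀ φ → InT R φ → IsBAAut R φ → ∀ a → Inverse.to φ a ≡ a
  T∩Aut[Ba]-trivial φ (c , φ≗t) (_ , _ , φ-0 , _) a = begin
      Inverse.to φ a   ≡⟨ φ≗t a ⟩
      a + c            ≡⟨ cong (a +_) c≡0 ⟩
      a + 0#           ≡⟨ +-identityʳ a ⟩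
      a                ∎
    where
    c≡0 : c ≡ 0#
    c≡0 = trans (sym (+-identityˡ c)) (trans (sym (φ≗t 0#)) φ-0)

  Aut[M]-generated : ∀ ψ → PreservesM R ψ → ∃ λ g → Generated R g × (∀ a → Inverse.to ψ a ≡ g a)
  Aut[M]-generated ψ ψ-median =
      _
    , gen-T (translation offset) (offset , λ _ → refl)
        (gen-Aut automorphism automorphism-isBAAut gen-id)
    , decompose
    where open Normalised ψ ψ-median

theorem2p3 : (R : BooleanRing) → Countable R → Nontrivial R → Atomless R
             → SemidirectDecomposition R
theorem2p3 R _ _ _ =
  T⊆Aut[M] , Aut[Ba]⊆Aut[M] , T-normal , T∩Aut[Ba]-trivial , Aut[M]-generated
  where open BooleanRingTheory R
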